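{- Let $\mathbb{F}$ be a field with $\mathrm{char}(\mathbb{F})\neq2$ and let $X\subseteq M_\Omega(\mathbb{F})$ be a set of symmetric matrices. Then $J(X)=\widetilde{WL(X)}$ if and only if $J(X)$ is non-proper.
   Context: A coherent algebra is a subspace of $M_\Omega(\mathbb{F})$ containing the identity $I_\Omega$ and the all-one matrix $J_\Omega$, closed under transposition, the ordinary matrix product and the entrywise product $\circ$. A coherent Jordan algebra is defined in the same way with the ordinary product replaced by the Jordan product $A\star B=\frac12(AB+BA)$. For $X\subseteq M_\Omega(\mathbb{F})$, $WL(X)$ is the intersection of all coherent algebras containing $X$, and $J(X)$ is the intersection of all coherent Jordan algebras containing $X$. For a coherent algebra $\mathcal{A}$, its symmetrization $\widetilde{\mathcal{A}}$ is $\{A\in\mathcal{A}:A^\top=A\}$. A coherent Jordan algebra $\mathcal{J}$ is non-proper if $\mathcal{J}=\widetilde{\mathcal{A}}$ for some coherent algebra $\mathcal{A}$, and proper otherwise. -}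

module Defs where

open import Level using (Level; _⊔_; suc)
open import Algebra.Bundles using (CommutativeRing)
open import Data.Nat using (ℕ)
open import Data.Fin using (Fin; _≟_)
open import Data.Product using (Σ; _×_; ∃)
open import Relation.Nullary using (¬_; yes; no)
open import Relation.Unary using (Pred; _∈_)

record Field (c ℓ : Level) : Set (suc (c ⊔ ℓ)) where
  field
    commutativeRing : CommutativeRing c ℓ
  open CommutativeRing commutativeRing public
  field
    1≉0     : ¬ (1# ≈ 0#)
    inverse : ∀ x → ¬ (x ≈ 0#) → Σ Carrier λ y → (x * y) ≈ 1#

module MatrixTheory {c ℓ : Level} (F : Field c ℓ) where
  open Field F

  CharNot2 : Set ℓ
  CharNot2 = ¬ ((1# + 1#) ≈ 0#)

  -- matrices indexed by Ω = Fin n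
  Mat : ℕ → Set c
  Mat n = Fin n → Fin n → Carrier

  module _ {n : ℕ} where

    _≈ₘ_ : Mat n → Mat n → Set ℓ
    A ≈ₘ B = ∀ i j → A i j ≈ B i j

    sumFin : ∀ {m} → (Fin m → Carrier) → Carrier
    sumFin {ℕ.zero}  f = 0#
    sumFin {ℕ.suc m} f = f Fin.zero + sumFin (λ i → f (Fin.suc i))

    0ₘ : Mat n
    0ₘ i j = 0#

    Iₘ : Mat n
    Iₘ i j with i ≟ j
    ... | yes _ = 1#
    ... | no  _ = 0#

    Jₘ : Mat n
    Jₘ i j = 1#

    _+ₘ_ : Mat n → Mat n → Mat n
    (A +ₘ B) i j = A i j + B i j

    _·ₘ_ : Carrier → Mat n → Mat n
    (a ·ₘ A) i j = a * A i j

    _*ₘ_ : Mat n → Mat n → Mat n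
    (A *ₘ B) i j = sumFin (λ k → A i k * B k j)

    _∘ₘ_ : Mat n → Mat n → Mat n
    (A ∘ₘ B) i j = A i j * B i j

    _ᵀ : Mat n → Mat n
    (A ᵀ) i j = A j i

    Symmetric : Mat n → Set ℓ
    Symmetric A = (A ᵀ) ≈ₘ A

    _⊆ₘ_ : ∀ {p q} → Pred (Mat n) p → Pred (Mat n) q → Set (c ⊔ p ⊔ q)
    S ⊆ₘ T = ∀ A → A ∈ S → A ∈ T

    _≐ₘ_ : ∀ {p q} → Pred (Mat n) p → Pred (Mat n) q → Set (c ⊔ p ⊔ q)
    S ≐ₘ T = (S ⊆ₘ T) × (T ⊆ₘ S)

    record IsSubspace {p} (S : Pred (Mat n) p) : Set (c ⊔ ℓ ⊔ p) where
      field
        respects : ∀ {A B} → A ≈ₘ B → A ∈ S → B ∈ S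
        zero∈    : 0ₘ ∈ S
        +-closed : ∀ {A B} → A ∈ S → B ∈ S → (A +ₘ B) ∈ S
        ·-closed : ∀ a {A} → A ∈ S → (a ·ₘ A) ∈ S

    record IsCoherentAlgebra {p} (S : Pred (Mat n) p) : Set (c ⊔ ℓ ⊔ p) where
      field
        subspace : IsSubspace S
        I∈       : Iₘ ∈ S
        J∈       : Jₘ ∈ S
        ᵀ-closed : ∀ {A} → A ∈ S → (A ᵀ) ∈ S
        *-closed : ∀ {A B} → A ∈ S → B ∈ S → (A *ₘ B) ∈ S
        ∘-closed : ∀ {A B} → A ∈ S → B ∈ S → (A ∘ₘ B) ∈ S

    -- Jordan product A ⋆ B = ½(AB + BA), where ½ is the element h with h·2 = 1
    -- (unique when it exists, i.e. when char F ≠ 2)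
    IsHalf : Carrier → Set ℓ
    IsHalf h = (h * (1# + 1#)) ≈ 1#

    _⋆[_]_ : Mat n → Carrier → Mat n → Mat n
    A ⋆[ h ] B = h ·ₘ ((A *ₘ B) +ₘ (B *ₘ A))

    record IsCoherentJordanAlgebra {p} (S : Pred (Mat n) p) : Set (c ⊔ ℓ ⊔ p) where
      field
        subspace : IsSubspace S
        I∈       : Iₘ ∈ S
        J∈       : Jₘ ∈ S
        ᵀ-closed : ∀ {A} → A ∈ S → (A ᵀ) ∈ S
        ⋆-closed : ∀ h → IsHalf h → ∀ {A B} → A ∈ S → B ∈ S → (A ⋆[ h ] B) ∈ S
        ∘-closed : ∀ {A B} → A ∈ S → B ∈ S → (A ∘ₘ B) ∈ S

    module Closures {p : Level} (X : Pred (Mat n) p) where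
      L : Level
      L = c ⊔ ℓ ⊔ p

      WL : Pred (Mat n) (c ⊔ suc L)
      WL A = (S : Pred (Mat n) L) → IsCoherentAlgebra S → X ⊆ₘ S → A ∈ S

      JX : Pred (Mat n) (c ⊔ suc L)
      JX A = (S : Pred (Mat n) L) → IsCoherentJordanAlgebra S → X ⊆ₘ S → A ∈ S

    Sym : ∀ {p} → Pred (Mat n) p → Pred (Mat n) (ℓ ⊔ p)
    Sym S A = (A ∈ S) × Symmetric A

    NonProper : ∀ {p} (q : Level) → Pred (Mat n) p → Set (c ⊔ ℓ ⊔ p ⊔ suc q)
    NonProper q 𝒥 = Σ (Pred (Mat n) q) λ 𝒜 → IsCoherentAlgebra 𝒜 × (𝒥 ≐ₘ Sym 𝒜)

-- Symmetric matrices A, B satisfy (AB)ᵀ = BA, so the symmetric part of any coherent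
-- algebra is closed under the Jordan product and hence is a coherent Jordan algebra.
-- Since X is symmetric, J(X) therefore lies in the symmetric part of every coherent
-- algebra containing X, i.e. J(X) ⊆ WL(X)~.  If J(X) = 𝒜~ for a coherent algebra 𝒜,
-- then X ⊆ 𝒜, so WL(X) ⊆ 𝒜 and WL(X)~ ⊆ 𝒜~ = J(X), giving equality.  Conversely, if
-- J(X) = WL(X)~ then J(X) is non-proper, witnessed by the coherent algebra generated
-- by X, built inductively so that it lives at the level over which WL(X) quantifies.
module Submission where

open import Defs
open import Level using (Level; _⊔_)
open import Data.Nat using (ℕ)
open import Data.Fin using (Fin; _≟_)
open import Data.Product using (_,_; proj₁; proj₂)
open import Data.Empty using (⊥-elim)
open import Relation.Nullary using (yes; no)
open import Relation.Unary using (Pred; _∈_)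
open import Function.Bundles using (_⇔_; mk⇔)
import Relation.Binary.PropositionalEquality as ≡

module CoherentSymmetrization {c ℓ : Level} (F : Field c ℓ) where
  open Field F
  open MatrixTheory F

  module _ {n : ℕ} where

    sumFin-cong : ∀ {m} {f g : Fin m → Carrier} → (∀ k → f k ≈ g k) →
                  sumFin {n} f ≈ sumFin {n} g
    sumFin-cong {ℕ.zero}  f≈g = refl
    sumFin-cong {ℕ.suc m} f≈g = +-cong (f≈g Fin.zero) (sumFin-cong (λ k → f≈g (Fin.suc k)))

    ⊆ₘ-trans : ∀ {p q r} {S : Pred (Mat n) p} {T : Pred (Mat n) q} {U : Pred (Mat n) r} →
               S ⊆ₘ T → T ⊆ₘ U → S ⊆ₘ U
    ⊆ₘ-trans S⊆T T⊆U A A∈S = T⊆U A (S⊆T A A∈S)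

    Sym-mono : ∀ {p q} {S : Pred (Mat n) p} {T : Pred (Mat n) q} → S ⊆ₘ T → Sym S ⊆ₘ Sym T
    Sym-mono S⊆T A (A∈S , symA) = S⊆T A A∈S , symA

    Iₘ-symmetric : Symmetric (Iₘ {n})
    Iₘ-symmetric i j with j ≟ i | i ≟ j
    ... | yes _   | yes _   = refl
    ... | no  _   | no  _   = refl
    ... | yes j≡i | no  i≢j = ⊥-elim (i≢j (≡.sym j≡i))
    ... | no  j≢i | yes i≡j = ⊥-elim (j≢i (≡.sym i≡j))

    *ₘ-ᵀ-symmetric : ∀ {A B : Mat n} → Symmetric A → Symmetric B → ((A *ₘ B) ᵀ) ≈ₘ (B *ₘ A)
    *ₘ-ᵀ-symmetric symA symB i j =
      sumFin-cong (λ k → trans (*-cong (symA k j) (symB i k)) (*-comm _ _))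

    ⋆-symmetric : ∀ h {A B : Mat n} → Symmetric A → Symmetric B → Symmetric (A ⋆[ h ] B)
    ⋆-symmetric h symA symB i j =
      *-cong refl (trans (+-cong (*ₘ-ᵀ-symmetric symA symB i j) (*ₘ-ᵀ-symmetric symB symA i j))
                         (+-comm _ _))

    Sym-isCoherentJordanAlgebra : ∀ {q} {S : Pred (Mat n) q} →
                                  IsCoherentAlgebra S → IsCoherentJordanAlgebra (Sym S)
    Sym-isCoherentJordanAlgebra {S = S} isCA = record
      { subspace = record
        { respects = λ A≈B (A∈S , symA) →
            SS.respects A≈B A∈S , (λ i j → trans (sym (A≈B j i)) (trans (symA i j) (A≈B i j)))
        ; zero∈    = SS.zero∈ , (λ i j → refl)
        ; +-closed = λ (A∈S , symA) (B∈S , symB) →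
            SS.+-closed A∈S B∈S , (λ i j → +-cong (symA i j) (symB i j))
        ; ·-closed = λ a (A∈S , symA) → SS.·-closed a A∈S , (λ i j → *-cong refl (symA i j))
        }
      ; I∈       = CA.I∈ , Iₘ-symmetric
      ; J∈       = CA.J∈ , (λ i j → refl)
      ; ᵀ-closed = λ (A∈S , symA) → CA.ᵀ-closed A∈S , (λ i j → sym (symA i j))
      ; ⋆-closed = λ h _ (A∈S , symA) (B∈S , symB) →
          SS.·-closed h (SS.+-closed (CA.*-closed A∈S B∈S) (CA.*-closed B∈S A∈S)) ,
          ⋆-symmetric h symA symB
      ; ∘-closed = λ (A∈S , symA) (B∈S , symB) →
          CA.∘-closed A∈S B∈S , (λ i j → *-cong (symA i j) (symB i j))
      }
      where
        module CA = IsCoherentAlgebra isCA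
        module SS = IsSubspace CA.subspace

    data CoherentClosure {p} (X : Pred (Mat n) p) : Pred (Mat n) (c ⊔ ℓ ⊔ p) where
      base      : ∀ {A} → A ∈ X → A ∈ CoherentClosure X
      respects  : ∀ {A B} → A ≈ₘ B → A ∈ CoherentClosure X → B ∈ CoherentClosure X
      null      : 0ₘ ∈ CoherentClosure X
      plus      : ∀ {A B} → A ∈ CoherentClosure X → B ∈ CoherentClosure X →
                  (A +ₘ B) ∈ CoherentClosure X
      scale     : ∀ a {A} → A ∈ CoherentClosure X → (a ·ₘ A) ∈ CoherentClosure X
      identity  : Iₘ ∈ CoherentClosure X
      all-one   : Jₘ ∈ CoherentClosure X
      transpose : ∀ {A} → A ∈ CoherentClosure X → (A ᵀ) ∈ CoherentClosure X
      product   : ∀ {A B} → A ∈ CoherentClosure X → B ∈ CoherentClosure X →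
                  (A *ₘ B) ∈ CoherentClosure X
      hadamard  : ∀ {A B} → A ∈ CoherentClosure X → B ∈ CoherentClosure X →
                  (A ∘ₘ B) ∈ CoherentClosure X

    module _ {p : Level} (X : Pred (Mat n) p) where
      open Closures X

      CoherentClosure-isCoherentAlgebra : IsCoherentAlgebra (CoherentClosure X)
      CoherentClosure-isCoherentAlgebra = record
        { subspace = record { respects = respects ; zero∈ = null ; +-closed = plus ; ·-closed = scale }
        ; I∈ = identity ; J∈ = all-one ; ᵀ-closed = transpose ; *-closed = product ; ∘-closed = hadamard }

      ⊆-CoherentClosure : X ⊆ₘ CoherentClosure X
      ⊆-CoherentClosure A = base

      CoherentClosure-least : ∀ {q} {S : Pred (Mat n) q} → IsCoherentAlgebra S → X ⊆ₘ S →
                              CoherentClosure X ⊆ₘ S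
      CoherentClosure-least {S = S} isCA X⊆S A = go
        where
          module CA = IsCoherentAlgebra isCA
          module SS = IsSubspace CA.subspace
          go : ∀ {B} → B ∈ CoherentClosure X → B ∈ S
          go (base B∈X)     = X⊆S _ B∈X
          go (respects e g) = SS.respects e (go g)
          go null           = SS.zero∈
          go (plus g h)     = SS.+-closed (go g) (go h)
          go (scale a g)    = SS.·-closed a (go g)
          go identity       = CA.I∈
          go all-one        = CA.J∈
          go (transpose g)  = CA.ᵀ-closed (go g)
          go (product g h)  = CA.*-closed (go g) (go h)
          go (hadamard g h) = CA.∘-closed (go g) (go h)

      CoherentClosure⊆WL : CoherentClosure X ⊆ₘ WL
      CoherentClosure⊆WL A A∈cl S isCA X⊆S = CoherentClosure-least isCA X⊆S A A∈cl

      WL⊆CoherentClosure : WL ⊆ₘ CoherentClosure X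
      WL⊆CoherentClosure A A∈WL =
        A∈WL (CoherentClosure X) CoherentClosure-isCoherentAlgebra ⊆-CoherentClosure

      X⊆JX : X ⊆ₘ JX
      X⊆JX A A∈X S _ X⊆S = X⊆S A A∈X

      module _ (symX : ∀ A → A ∈ X → Symmetric A) where

        JX⊆Sym : ∀ {S : Pred (Mat n) L} → IsCoherentAlgebra S → X ⊆ₘ S → JX ⊆ₘ Sym S
        JX⊆Sym {S} isCA X⊆S A A∈JX =
          A∈JX (Sym S) (Sym-isCoherentJordanAlgebra isCA) (λ B B∈X → X⊆S B B∈X , symX B B∈X)

        JX⊆SymWL : JX ⊆ₘ Sym WL
        JX⊆SymWL A A∈JX =
          (λ S isCA X⊆S → proj₁ (JX⊆Sym isCA X⊆S A A∈JX)) ,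
          proj₂ (JX⊆Sym CoherentClosure-isCoherentAlgebra ⊆-CoherentClosure A A∈JX)

        nonProper-if-SymWL : JX ≐ₘ Sym WL → NonProper L JX
        nonProper-if-SymWL (_ , SymWL⊆JX) =
          CoherentClosure X , CoherentClosure-isCoherentAlgebra ,
          ⊆ₘ-trans JX⊆SymWL (Sym-mono WL⊆CoherentClosure) ,
          ⊆ₘ-trans (Sym-mono CoherentClosure⊆WL) SymWL⊆JX

        SymWL-if-nonProper : NonProper L JX → JX ≐ₘ Sym WL
        SymWL-if-nonProper (𝒜 , isCA , JX⊆Sym𝒜 , Sym𝒜⊆JX) =
          JX⊆SymWL ,
          ⊆ₘ-trans (Sym-mono WL⊆𝒜) Sym𝒜⊆JX
          where
            WL⊆𝒜 : WL ⊆ₘ 𝒜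
            WL⊆𝒜 A A∈WL = A∈WL 𝒜 isCA (⊆ₘ-trans X⊆JX (λ B B∈JX → proj₁ (JX⊆Sym𝒜 B B∈JX)))

proposition1p6 : ∀ {c ℓ p : Level} (F : Field c ℓ) → let open MatrixTheory F in
    CharNot2 → (n : ℕ) (X : Pred (Mat n) p) →
    (∀ A → A ∈ X → Symmetric A) →
    let open Closures X in
    (JX ≐ₘ Sym WL) ⇔ NonProper L JX
proposition1p6 F _ n X symX =
  mk⇔ (nonProper-if-SymWL X symX) (SymWL-if-nonProper X symX)
  where open CoherentSymmetrization F
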